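{- Let $r\geqslant 2$ be an integer, $q$ a prime power, $K=\mathbb{F}_q(t)$, and for $z\in\overline{K}$ let $\Phi^{(z)}$ be the Drinfeld module with $\Phi^{(z)}_T(x)=tx+zx^q+x^{q^r}$. Let $0\neq\mathbf a\in K$ and let $P(T)\in\mathbb{F}_q[T]$ be non-constant. Then the map $z\mapsto\Phi^{(z)}_{P(T)}(\mathbf a)$ is a polynomial in $K[z]$ of degree $q^{r(\deg P(T)-1)}$.
   Context: For a Drinfeld module $\Phi$ determined by $\Phi_T$, one has $\Phi_{\sum_i c_iT^i}(x)=\sum_i c_i\,\Phi_T^{\circ i}(x)$, where $\Phi_T^{\circ i}$ is the $i$-fold composition; here $z$ is treated as an indeterminate. -}

module Defs where

open import Level using (Level; _⊔_)
open import Algebra.Bundles using (CommutativeRing)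
open import Data.Nat as ℕ using (ℕ; zero; suc; _<_)
open import Data.Nat.Primality using (Prime)
open import Data.Fin using (Fin)
open import Data.List using (List; []; _∷_)
open import Data.Product using (Σ; ∃; _×_; _,_)
open import Relation.Nullary using (¬_)
open import Relation.Binary.PropositionalEquality using (_≡_)

IsPrimePower : ℕ → Set
IsPrimePower q = Σ ℕ λ p → Σ ℕ λ k → Prime p × q ≡ p ℕ.^ suc k

record IsFiniteFieldOfSize {c ℓ : Level} (F : CommutativeRing c ℓ) (q : ℕ) : Set (c ⊔ ℓ) where
  open CommutativeRing F
  field
    one≉zero : ¬ (1# ≈ 0#)
    inverse  : ∀ x → ¬ (x ≈ 0#) → Σ Carrier λ y → x * y ≈ 1#
    enum     : Fin q → Carrier
    enum-inj : ∀ i j → enum i ≈ enum j → i ≡ j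
    enum-sur : ∀ x → Σ (Fin q) λ i → enum i ≈ x

-- Dense univariate polynomials over a commutative ring: coefficient lists,
-- constant term first.  Equality / degree are defined through `coeff`, so
-- trailing zero coefficients are harmless.
module Poly {c ℓ : Level} (A : CommutativeRing c ℓ) where
  open CommutativeRing A

  Pol : Set c
  Pol = List Carrier

  coeff : Pol → ℕ → Carrier
  coeff []       _       = 0#
  coeff (a ∷ p)  zero    = a
  coeff (a ∷ p)  (suc n) = coeff p n

  _≈ₚ_ : Pol → Pol → Set ℓ
  p ≈ₚ p' = ∀ n → coeff p n ≈ coeff p' n

  const : Carrier → Pol
  const a = a ∷ []

  X : Pol
  X = 0# ∷ 1# ∷ []

  _+ₚ_ : Pol → Pol → Pol
  []      +ₚ p'       = p'
  (a ∷ p) +ₚ []       = a ∷ p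
  (a ∷ p) +ₚ (b ∷ p') = (a + b) ∷ (p +ₚ p')

  _·ₚ_ : Carrier → Pol → Pol
  a ·ₚ []      = []
  a ·ₚ (b ∷ p) = (a * b) ∷ (a ·ₚ p)

  -ₚ_ : Pol → Pol
  -ₚ []      = []
  -ₚ (a ∷ p) = (- a) ∷ (-ₚ p)

  _*ₚ_ : Pol → Pol → Pol
  []      *ₚ p' = []
  (a ∷ p) *ₚ p' = (a ·ₚ p') +ₚ (0# ∷ (p *ₚ p'))

  _^ₚ_ : Pol → ℕ → Pol
  p ^ₚ zero  = const 1#
  p ^ₚ suc n = p *ₚ (p ^ₚ n)

  HasDegree : Pol → ℕ → Set ℓ
  HasDegree p d = ¬ (coeff p d ≈ 0#) × (∀ m → d < m → coeff p m ≈ 0#)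

-- The rational function field K = F(t), as fractions num/den of elements of
-- F[t], with a/b ≈ c/d  iff  a*d ≈ c*b in F[t].  An element is a genuine
-- element of K when its denominator is a nonzero polynomial (`ValidK`).
module RatFun {c ℓ : Level} (F : CommutativeRing c ℓ) where
  open CommutativeRing F using (0#; 1#)
  open Poly F

  record K : Set c where
    constructor _/_
    field
      num : Pol
      den : Pol
  open K public

  _≈K_ : K → K → Set ℓ
  x ≈K y = (num x *ₚ den y) ≈ₚ (num y *ₚ den x)

  ValidK : K → Set ℓ
  ValidK x = ¬ (den x ≈ₚ [])

  0K 1K tK : K
  0K = [] / const 1#
  1K = const 1# / const 1#
  tK = X / const 1#

  ιK : CommutativeRing.Carrier F → K
  ιK a = const a / const 1#

  _+K_ : K → K → K
  x +K y = ((num x *ₚ den y) +ₚ (num y *ₚ den x)) / (den x *ₚ den y)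

  _*K_ : K → K → K
  x *K y = (num x *ₚ num y) / (den x *ₚ den y)

  KPol : Set c
  KPol = List K

  coeffZ : KPol → ℕ → K
  coeffZ []      _       = 0K
  coeffZ (a ∷ p) zero    = a
  coeffZ (a ∷ p) (suc n) = coeffZ p n

  _+Z_ : KPol → KPol → KPol
  []      +Z p'       = p'
  (a ∷ p) +Z []       = a ∷ p
  (a ∷ p) +Z (b ∷ p') = (a +K b) ∷ (p +Z p')

  _·Z_ : K → KPol → KPol
  a ·Z []      = []
  a ·Z (b ∷ p) = (a *K b) ∷ (a ·Z p)

  _*Z_ : KPol → KPol → KPol
  []      *Z p' = []
  (a ∷ p) *Z p' = (a ·Z p') +Z (0K ∷ (p *Z p'))

  _^Z_ : KPol → ℕ → KPol
  p ^Z zero  = 1K ∷ []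
  p ^Z suc n = p *Z (p ^Z n)

  z : KPol
  z = 0K ∷ 1K ∷ []

  HasDegreeZ : KPol → ℕ → Set ℓ
  HasDegreeZ p d = ¬ (coeffZ p d ≈K 0K) × (∀ m → d < m → coeffZ p m ≈K 0K)

  module Drinfeld (q r : ℕ) where
    ΦT : KPol → KPol
    ΦT x = (tK ·Z x) +Z ((z *Z (x ^Z q)) +Z (x ^Z (q ℕ.^ r)))

    ΦT^ : ℕ → KPol → KPol
    ΦT^ zero    x = x
    ΦT^ (suc i) x = ΦT (ΦT^ i x)

    -- Φ_{Σ c_i T^i}(x) = Σ c_i Φ_T^{∘ i}(x), P given by its coefficient list
    -- over 𝔽_q (constant term first); `i` is the current index.
    ΦP-from : ℕ → Pol → KPol → KPol
    ΦP-from i []      x = []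
    ΦP-from i (c ∷ P) x = (ιK c ·Z ΦT^ i x) +Z ΦP-from (suc i) P x

    Φ : Pol → KPol → KPol
    Φ P x = ΦP-from zero P x

-- Iterating Φ_T on a constant a ≠ 0 gives z-degrees 0, 1, q^r, q^(2r), …: on a
-- constant the summand z·x^q contributes degree 1, and once deg x = D ≥ 1 the
-- summand x^(q^r), of degree q^r·D, dominates t·x and z·x^q (degree 1 + qD).  As
-- these degrees strictly increase, the top term c_d Φ_T^{∘d}(a) alone fixes the
-- degree of Φ_P(a) = Σ c_i Φ_T^{∘i}(a), namely q^(r(d-1)).  Degrees add under
-- products because F(t) has no zero divisors, which rests on F[t] being an
-- integral domain: F is a field whose equality is decidable, being finite.

module Submission where

open import Defs
open import Level using (Level; _⊔_; 0ℓ) renaming (suc to lsuc)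
open import Algebra.Bundles using (CommutativeRing)
open import Data.Nat using (ℕ; zero; suc; _+_; _*_; _^_; _∸_; _≤_; _<_; z≤n; s≤s; >-nonZero)
open import Data.Nat.Properties using (≤-refl; ≤-trans; n≤1+n; m≤n+m; +-identityʳ; +-suc; *-zeroʳ; m^n>0)
open import Data.Fin using () renaming (_≟_ to _≟ᶠ_)
open import Data.List using (List; []; _∷_)
open import Data.Product using (∃; _×_; _,_; proj₂)
open import Data.Sum using (_⊎_; inj₁; inj₂)
open import Data.Unit using (⊤; tt)
open import Data.Empty using (⊥-elim)
open import Function using (_∘_)
open import Relation.Nullary using (¬_; yes; no)
open import Relation.Unary using (Decidable)
open import Relation.Binary.PropositionalEquality using (_≡_; refl; sym; trans; cong; cong₂; subst)
import Relation.Binary.Reasoning.Setoid as ≈-Reasoning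

-- Elements of F(t) are pairs num/den with no constraint on den, so "being zero"
-- (num = 0) only behaves like the zero set of an integral domain on the valid
-- elements (den ≠ 0).  DomainLike axiomatises this situation.
record DomainLike (c z v : Level) : Set (lsuc (c ⊔ z ⊔ v)) where
  infixl 6 _⊕_
  infixl 7 _⊛_
  field
    Carrier    : Set c
    0# 1#      : Carrier
    _⊕_ _⊛_    : Carrier → Carrier → Carrier
    IsZero     : Carrier → Set z
    Valid      : Carrier → Set v
    0-isZero   : IsZero 0#
    1-nonZero  : ¬ IsZero 1#
    0-valid    : Valid 0#
    1-valid    : Valid 1#
    +-valid    : ∀ {x y} → Valid x → Valid y → Valid (x ⊕ y)
    *-valid    : ∀ {x y} → Valid x → Valid y → Valid (x ⊛ y)
    +-isZero   : ∀ {x y} → IsZero x → IsZero y → IsZero (x ⊕ y)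
    +-nonZeroˡ : ∀ {x y} → ¬ IsZero x → IsZero y → Valid y → ¬ IsZero (x ⊕ y)
    +-nonZeroʳ : ∀ {x y} → IsZero x → Valid x → ¬ IsZero y → ¬ IsZero (x ⊕ y)
    *-isZeroˡ  : ∀ {x y} → IsZero x → IsZero (x ⊛ y)
    *-isZeroʳ  : ∀ {x y} → IsZero y → IsZero (x ⊛ y)
    *-nonZero  : ∀ {x y} → ¬ IsZero x → ¬ IsZero y → ¬ IsZero (x ⊛ y)

module Polynomials {c z v : Level} (D : DomainLike c z v) where
  open DomainLike D

  infixl 6 _+ₗ_
  infixl 7 _·ₗ_ _*ₗ_
  infixr 8 _^ₗ_

  coeffₗ : List Carrier → ℕ → Carrier
  coeffₗ []      _       = 0#
  coeffₗ (a ∷ p) zero    = a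
  coeffₗ (a ∷ p) (suc n) = coeffₗ p n

  _+ₗ_ : List Carrier → List Carrier → List Carrier
  []      +ₗ p'       = p'
  (a ∷ p) +ₗ []       = a ∷ p
  (a ∷ p) +ₗ (b ∷ p') = (a ⊕ b) ∷ (p +ₗ p')

  _·ₗ_ : Carrier → List Carrier → List Carrier
  a ·ₗ []      = []
  a ·ₗ (b ∷ p) = (a ⊛ b) ∷ (a ·ₗ p)

  _*ₗ_ : List Carrier → List Carrier → List Carrier
  []      *ₗ p' = []
  (a ∷ p) *ₗ p' = (a ·ₗ p') +ₗ (0# ∷ (p *ₗ p'))

  _^ₗ_ : List Carrier → ℕ → List Carrier
  p ^ₗ zero  = 1# ∷ []
  p ^ₗ suc n = p *ₗ (p ^ₗ n)

  IsZeroPoly : List Carrier → Set z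
  IsZeroPoly p = ∀ n → IsZero (coeffₗ p n)

  AllValid : List Carrier → Set v
  AllValid p = ∀ n → Valid (coeffₗ p n)

  DegreeBelow : List Carrier → ℕ → Set z
  DegreeBelow p n = ∀ m → n ≤ m → IsZero (coeffₗ p m)

  ExactDegree : List Carrier → ℕ → Set z
  ExactDegree p d = ¬ IsZero (coeffₗ p d) × DegreeBelow p (suc d)

  +-isZeroCoeff : ∀ p p' n → IsZero (coeffₗ p n) → IsZero (coeffₗ p' n) → IsZero (coeffₗ (p +ₗ p') n)
  +-isZeroCoeff []      p'       n       _ h' = h'
  +-isZeroCoeff (a ∷ p) []       n       h _  = h
  +-isZeroCoeff (a ∷ p) (b ∷ p') zero    h h' = +-isZero h h'
  +-isZeroCoeff (a ∷ p) (b ∷ p') (suc n) h h' = +-isZeroCoeff p p' n h h'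

  +-nonZeroCoeffˡ : ∀ p p' n → ¬ IsZero (coeffₗ p n) → IsZero (coeffₗ p' n) → Valid (coeffₗ p' n) →
                    ¬ IsZero (coeffₗ (p +ₗ p') n)
  +-nonZeroCoeffˡ []      p'       n       h _  _ = ⊥-elim (h 0-isZero)
  +-nonZeroCoeffˡ (a ∷ p) []       n       h _  _ = h
  +-nonZeroCoeffˡ (a ∷ p) (b ∷ p') zero    h h' v = +-nonZeroˡ h h' v
  +-nonZeroCoeffˡ (a ∷ p) (b ∷ p') (suc n) h h' v = +-nonZeroCoeffˡ p p' n h h' v

  +-nonZeroCoeffʳ : ∀ p p' n → IsZero (coeffₗ p n) → Valid (coeffₗ p n) → ¬ IsZero (coeffₗ p' n) →
                    ¬ IsZero (coeffₗ (p +ₗ p') n)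
  +-nonZeroCoeffʳ []      p'       n       _ _ h' = h'
  +-nonZeroCoeffʳ (a ∷ p) []       n       _ _ h' = ⊥-elim (h' 0-isZero)
  +-nonZeroCoeffʳ (a ∷ p) (b ∷ p') zero    h v h' = +-nonZeroʳ h v h'
  +-nonZeroCoeffʳ (a ∷ p) (b ∷ p') (suc n) h v h' = +-nonZeroCoeffʳ p p' n h v h'

  ·-isZeroCoeffˡ : ∀ a p n → IsZero a → IsZero (coeffₗ (a ·ₗ p) n)
  ·-isZeroCoeffˡ a []      n       _ = 0-isZero
  ·-isZeroCoeffˡ a (b ∷ p) zero    h = *-isZeroˡ h
  ·-isZeroCoeffˡ a (b ∷ p) (suc n) h = ·-isZeroCoeffˡ a p n h

  ·-isZeroCoeffʳ : ∀ a p n → IsZero (coeffₗ p n) → IsZero (coeffₗ (a ·ₗ p) n)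
  ·-isZeroCoeffʳ a []      n       h = h
  ·-isZeroCoeffʳ a (b ∷ p) zero    h = *-isZeroʳ h
  ·-isZeroCoeffʳ a (b ∷ p) (suc n) h = ·-isZeroCoeffʳ a p n h

  ·-nonZeroCoeff : ∀ a p n → ¬ IsZero a → ¬ IsZero (coeffₗ p n) → ¬ IsZero (coeffₗ (a ·ₗ p) n)
  ·-nonZeroCoeff a []      n       _  h = h
  ·-nonZeroCoeff a (b ∷ p) zero    ha h = *-nonZero ha h
  ·-nonZeroCoeff a (b ∷ p) (suc n) ha h = ·-nonZeroCoeff a p n ha h

  ∷-allValid : ∀ {a p} → Valid a → AllValid p → AllValid (a ∷ p)
  ∷-allValid va _  zero    = va
  ∷-allValid _  vp (suc n) = vp n

  ∷-isZeroPoly : ∀ {a p} → IsZero a → IsZeroPoly p → IsZeroPoly (a ∷ p)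
  ∷-isZeroPoly ha _  zero    = ha
  ∷-isZeroPoly _  hp (suc n) = hp n

  +-allValid : ∀ p p' → AllValid p → AllValid p' → AllValid (p +ₗ p')
  +-allValid []      p'       _ v' n       = v' n
  +-allValid (a ∷ p) []       v _  n       = v n
  +-allValid (a ∷ p) (b ∷ p') v v' zero    = +-valid (v zero) (v' zero)
  +-allValid (a ∷ p) (b ∷ p') v v' (suc n) = +-allValid p p' (v ∘ suc) (v' ∘ suc) n

  ·-allValid : ∀ a p → Valid a → AllValid p → AllValid (a ·ₗ p)
  ·-allValid a []      _  _ _       = 0-valid
  ·-allValid a (b ∷ p) va v zero    = *-valid va (v zero)
  ·-allValid a (b ∷ p) va v (suc n) = ·-allValid a p va (v ∘ suc) n

  *-allValid : ∀ p p' → AllValid p → AllValid p' → AllValid (p *ₗ p')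
  *-allValid []      p' _ _  _ = 0-valid
  *-allValid (a ∷ p) p' v v' =
    +-allValid (a ·ₗ p') _ (·-allValid a p' (v zero) v') (∷-allValid 0-valid (*-allValid p p' (v ∘ suc) v'))

  ^-allValid : ∀ p n → AllValid p → AllValid (p ^ₗ n)
  ^-allValid p zero    _ = ∷-allValid 1-valid (λ _ → 0-valid)
  ^-allValid p (suc n) v = *-allValid p (p ^ₗ n) v (^-allValid p n v)

  degreeBelow-mono : ∀ p {m n} → DegreeBelow p m → m ≤ n → DegreeBelow p n
  degreeBelow-mono p h m≤n k n≤k = h k (≤-trans m≤n n≤k)

  exactDegree⇒degreeBelow : ∀ p {d n} → ExactDegree p d → d < n → DegreeBelow p n
  exactDegree⇒degreeBelow p (_ , below) = degreeBelow-mono p below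

  +-degreeBelow : ∀ p p' {n} → DegreeBelow p n → DegreeBelow p' n → DegreeBelow (p +ₗ p') n
  +-degreeBelow p p' h h' m le = +-isZeroCoeff p p' m (h m le) (h' m le)

  ·-degreeBelow : ∀ a p {n} → DegreeBelow p n → DegreeBelow (a ·ₗ p) n
  ·-degreeBelow a p h m le = ·-isZeroCoeffʳ a p m (h m le)

  +-exactDegreeˡ : ∀ p p' {d} → ExactDegree p d → DegreeBelow p' d → AllValid p' → ExactDegree (p +ₗ p') d
  +-exactDegreeˡ p p' {d} (nz , below) below' v' =
    +-nonZeroCoeffˡ p p' d nz (below' d ≤-refl) (v' d) ,
    +-degreeBelow p p' below (degreeBelow-mono p' below' (n≤1+n d))

  +-exactDegreeʳ : ∀ p p' {d} → DegreeBelow p d → AllValid p → ExactDegree p' d → ExactDegree (p +ₗ p') d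
  +-exactDegreeʳ p p' {d} below v (nz' , below') =
    +-nonZeroCoeffʳ p p' d (below d ≤-refl) (v d) nz' ,
    +-degreeBelow p p' (degreeBelow-mono p below (n≤1+n d)) below'

  ·-exactDegree : ∀ a p {d} → ¬ IsZero a → ExactDegree p d → ExactDegree (a ·ₗ p) d
  ·-exactDegree a p {d} ha (nz , below) = ·-nonZeroCoeff a p d ha nz , ·-degreeBelow a p below

  *-isZeroPolyˡ : ∀ p p' → IsZeroPoly p → IsZeroPoly (p *ₗ p')
  *-isZeroPolyˡ []      p' _ _ = 0-isZero
  *-isZeroPolyˡ (a ∷ p) p' h n =
    +-isZeroCoeff (a ·ₗ p') _ n (·-isZeroCoeffˡ a p' n (h zero)) (∷-isZeroPoly 0-isZero (*-isZeroPolyˡ p p' (h ∘ suc)) n)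

  *-isZeroPolyʳ : ∀ p p' → IsZeroPoly p' → IsZeroPoly (p *ₗ p')
  *-isZeroPolyʳ []      p' _ _ = 0-isZero
  *-isZeroPolyʳ (a ∷ p) p' h n =
    +-isZeroCoeff (a ·ₗ p') _ n (·-isZeroCoeffʳ a p' n (h n)) (∷-isZeroPoly 0-isZero (*-isZeroPolyʳ p p' h) n)

  *-degreeBelow : ∀ p p' {m n} → DegreeBelow p m → DegreeBelow p' (suc n) → DegreeBelow (p *ₗ p') (m + n)
  *-degreeBelow []      p'         _ _  _ _ = 0-isZero
  *-degreeBelow (a ∷ p) p' {zero}  h _  k _ = *-isZeroPolyˡ (a ∷ p) p' (λ j → h j z≤n) k
  *-degreeBelow (a ∷ p) p' {suc m} {n} h h' k le =
    +-isZeroCoeff (a ·ₗ p') _ k (·-isZeroCoeffʳ a p' k (h' k (≤-trans (s≤s (m≤n+m n m)) le))) (shifted k le)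
    where
    shifted : DegreeBelow (0# ∷ (p *ₗ p')) (suc (m + n))
    shifted (suc k) (s≤s le) = *-degreeBelow p p' (λ j le → h (suc j) (s≤s le)) h' k le

  *-leadingCoeff : ∀ p p' {d e} → ExactDegree p d → AllValid p → ExactDegree p' e → AllValid p' →
                   ¬ IsZero (coeffₗ (p *ₗ p') (d + e))
  *-leadingCoeff []      p' (nz , _) _ _ _ = ⊥-elim (nz 0-isZero)
  *-leadingCoeff (a ∷ p) p' {zero} {e} (nz , below) v (nz' , _) v' =
    +-nonZeroCoeffˡ (a ·ₗ p') _ e (·-nonZeroCoeff a p' e nz nz')
      (∷-isZeroPoly 0-isZero (*-isZeroPolyˡ p p' (λ j → below (suc j) (s≤s z≤n))) e)
      (∷-allValid 0-valid (*-allValid p p' (v ∘ suc) v') e)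
  *-leadingCoeff (a ∷ p) p' {suc d} {e} (nz , below) v ed'@(_ , below') v' =
    +-nonZeroCoeffʳ (a ·ₗ p') _ (suc (d + e))
      (·-isZeroCoeffʳ a p' _ (below' _ (s≤s (m≤n+m e d))))
      (·-allValid a p' (v zero) v' _)
      (*-leadingCoeff p p' (nz , λ j le → below (suc j) (s≤s le)) (v ∘ suc) ed' v')

  *-exactDegree : ∀ p p' {d e} → ExactDegree p d → AllValid p → ExactDegree p' e → AllValid p' →
                  ExactDegree (p *ₗ p') (d + e)
  *-exactDegree p p' ed v ed' v' = *-leadingCoeff p p' ed v ed' v' , *-degreeBelow p p' (proj₂ ed) (proj₂ ed')

  ^-exactDegree : ∀ p {d} → ExactDegree p d → AllValid p → ∀ n → ExactDegree (p ^ₗ n) (n * d)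
  ^-exactDegree p _  _ zero    = 1-nonZero , λ { (suc m) _ → 0-isZero }
  ^-exactDegree p ed v (suc n) = *-exactDegree p (p ^ₗ n) ed v (^-exactDegree p ed v n) (^-allValid p n v)

  module _ (isZero? : Decidable IsZero) where

    isZeroPoly⊎exactDegree : ∀ p → IsZeroPoly p ⊎ ∃ (ExactDegree p)
    isZeroPoly⊎exactDegree []      = inj₁ (λ _ → 0-isZero)
    isZeroPoly⊎exactDegree (a ∷ p) with isZeroPoly⊎exactDegree p
    ... | inj₂ (d , nz , below) = inj₂ (suc d , nz , λ { (suc m) (s≤s le) → below m le })
    ... | inj₁ hp with isZero? a
    ...   | yes ha = inj₁ (∷-isZeroPoly ha hp)
    ...   | no  na = inj₂ (0 , na , λ { (suc m) _ → hp m })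

    *-nonZeroPoly : ∀ p p' → AllValid p → AllValid p' → ¬ IsZeroPoly p → ¬ IsZeroPoly p' → ¬ IsZeroPoly (p *ₗ p')
    *-nonZeroPoly p p' v v' np np' h with isZeroPoly⊎exactDegree p | isZeroPoly⊎exactDegree p'
    ... | inj₁ hp | _ = np hp
    ... | inj₂ _ | inj₁ hp' = np' hp'
    ... | inj₂ (d , ed) | inj₂ (e , ed') = *-leadingCoeff p p' ed v ed' v' (h (d + e))

    +-nonZeroPolyˡ : ∀ p p' → ¬ IsZeroPoly p → IsZeroPoly p' → AllValid p' → ¬ IsZeroPoly (p +ₗ p')
    +-nonZeroPolyˡ p p' np h' v' h with isZeroPoly⊎exactDegree p
    ... | inj₁ hp = np hp
    ... | inj₂ (d , nz , _) = +-nonZeroCoeffˡ p p' d nz (h' d) (v' d) (h d)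

    +-nonZeroPolyʳ : ∀ p p' → IsZeroPoly p → AllValid p → ¬ IsZeroPoly p' → ¬ IsZeroPoly (p +ₗ p')
    +-nonZeroPolyʳ p p' hp v np' h with isZeroPoly⊎exactDegree p'
    ... | inj₁ hp' = np' hp'
    ... | inj₂ (d , nz , _) = +-nonZeroCoeffʳ p p' d (hp d) (v d) nz (h d)

module Arithmetic where
  open import Data.Nat.Properties
  open import Data.Nat.Primality using (prime⇒nonZero; prime⇒nonTrivial)
  open import Data.Nat.Base using (nonTrivial⇒n>1)

  isPrimePower⇒2≤ : ∀ {q} → IsPrimePower q → 2 ≤ q
  isPrimePower⇒2≤ (p , k , p-prime , refl) = ≤-trans (nonTrivial⇒n>1 p) (m≤m*n p (p ^ k))
    where
    instance
      _ = prime⇒nonTrivial p-prime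
      _ = prime⇒nonZero p-prime
      _ = m^n≢0 p k

  2+q*D≤q^r*D : ∀ {q r D} → 2 ≤ q → 2 ≤ r → 1 ≤ D → 2 + q * D ≤ q ^ r * D
  2+q*D≤q^r*D {q@(suc _)} {r} {D} q≥2 r≥2 D≥1 = begin
    2 + q * D           ≤⟨ +-monoˡ-≤ (q * D) (*-mono-≤ q≥2 D≥1) ⟩
    q * D + q * D       ≡⟨ cong (q * D +_) (sym (+-identityʳ (q * D))) ⟩
    2 * (q * D)         ≤⟨ *-monoˡ-≤ (q * D) q≥2 ⟩
    q * (q * D)         ≡⟨ sym (*-assoc q q D) ⟩
    q * q * D           ≡⟨ cong (λ m → q * m * D) (sym (*-identityʳ q)) ⟩
    q ^ 2 * D           ≤⟨ *-monoˡ-≤ D (^-monoʳ-≤ q r≥2) ⟩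
    q ^ r * D           ∎
    where open ≤-Reasoning

  1+D≤q^r*D : ∀ {q r D} → 2 ≤ q → 2 ≤ r → 1 ≤ D → 1 + D ≤ q ^ r * D
  1+D≤q^r*D {q@(suc _)} {r} {D} q≥2 r≥2 D≥1 =
    ≤-trans (s≤s (≤-trans (m≤n*m D q) (n≤1+n (q * D)))) (2+q*D≤q^r*D q≥2 r≥2 D≥1)

  increasing⇒< : (e : ℕ → ℕ) → (∀ j → e j < e (suc j)) → ∀ k i → e i < e (suc k + i)
  increasing⇒< e inc zero    i = inc i
  increasing⇒< e inc (suc k) i = <-trans (increasing⇒< e inc k i) (inc (suc k + i))

  -- The z-degree of Φ_T^{∘i}(a) for a constant a ≠ 0.
  iterateDegree : ℕ → ℕ → ℕ → ℕ
  iterateDegree q r zero    = 0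
  iterateDegree q r (suc i) = q ^ (r * i)

  iterateDegree-increasing : ∀ {q r} → 2 ≤ q → 1 ≤ r → ∀ i → iterateDegree q r i < iterateDegree q r (suc i)
  iterateDegree-increasing {q@(suc _)} {r}         _   _ zero    = m^n>0 q (r * 0)
  iterateDegree-increasing {q}         {r@(suc _)} q≥2 _ (suc i) = ^-monoʳ-< q q≥2 (*-monoʳ-< r (n<1+n i))

  iterateDegree-step : ∀ q r i → q ^ r * iterateDegree q r (suc i) ≡ iterateDegree q r (suc (suc i))
  iterateDegree-step q r i = sym (trans (cong (q ^_) (*-suc r i)) (^-distribˡ-+-* q r (r * i)))

open Arithmetic

module _ {c ℓ : Level} (F : CommutativeRing c ℓ) {q : ℕ} (F-field : IsFiniteFieldOfSize F q) where
  open CommutativeRing F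
    using (Carrier; 0#; 1#; _≈_; setoid; +-cong; +-congˡ; +-congʳ; +-identityˡ; zeroˡ; zeroʳ; *-congˡ; *-congʳ; *-comm)
    renaming (_+_ to _+ᶠ_; _*_ to _*ᶠ_; refl to ≈-refl; sym to ≈-sym; trans to ≈-trans;
              +-identityʳ to +ᶠ-identityʳ; *-assoc to *ᶠ-assoc; *-identityˡ to *ᶠ-identityˡ; *-identityʳ to *ᶠ-identityʳ)
  open IsFiniteFieldOfSize F-field
  open Poly F
  open RatFun F

  ≈0? : Decidable (_≈ 0#)
  ≈0? x with enum-sur x | enum-sur 0#
  ... | i , i↦x | j , j↦0 with i ≟ᶠ j
  ...   | yes refl = yes (≈-trans (≈-sym i↦x) j↦0)
  ...   | no  i≢j  = no (λ x≈0 → i≢j (enum-inj i j (≈-trans i↦x (≈-trans x≈0 (≈-sym j↦0)))))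

  *-nonZero : ∀ {x y} → ¬ x ≈ 0# → ¬ y ≈ 0# → ¬ (x *ᶠ y) ≈ 0#
  *-nonZero {x} {y} x≉0 y≉0 xy≈0 with inverse x x≉0
  ... | w , xw≈1 = y≉0 (begin
    y              ≈⟨ ≈-sym (*ᶠ-identityˡ y) ⟩
    1# *ᶠ y        ≈⟨ *-congʳ (≈-sym xw≈1) ⟩
    x *ᶠ w *ᶠ y    ≈⟨ *-congʳ (*-comm x w) ⟩
    w *ᶠ x *ᶠ y    ≈⟨ *ᶠ-assoc w x y ⟩
    w *ᶠ (x *ᶠ y)  ≈⟨ *-congˡ xy≈0 ⟩
    w *ᶠ 0#        ≈⟨ zeroʳ w ⟩
    0#             ∎)
    where open ≈-Reasoning setoid

  fieldDomain : DomainLike c ℓ 0ℓ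
  fieldDomain = record
    { Carrier    = Carrier
    ; 0#         = 0#
    ; 1#         = 1#
    ; _⊕_        = _+ᶠ_
    ; _⊛_        = _*ᶠ_
    ; IsZero     = _≈ 0#
    ; Valid      = λ _ → ⊤
    ; 0-isZero   = ≈-refl
    ; 1-nonZero  = one≉zero
    ; 0-valid    = tt
    ; 1-valid    = tt
    ; +-valid    = λ _ _ → tt
    ; *-valid    = λ _ _ → tt
    ; +-isZero   = λ x≈0 y≈0 → ≈-trans (+-cong x≈0 y≈0) (+-identityˡ 0#)
    ; +-nonZeroˡ = λ {x} x≉0 y≈0 _ x+y≈0 → x≉0 (≈-trans (≈-sym (+ᶠ-identityʳ x)) (≈-trans (+-congˡ (≈-sym y≈0)) x+y≈0))
    ; +-nonZeroʳ = λ {_} {y} x≈0 _ y≉0 x+y≈0 → y≉0 (≈-trans (≈-sym (+-identityˡ y)) (≈-trans (+-congʳ (≈-sym x≈0)) x+y≈0))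
    ; *-isZeroˡ  = λ {_} {y} x≈0 → ≈-trans (*-congʳ x≈0) (zeroˡ y)
    ; *-isZeroʳ  = λ {x} y≈0 → ≈-trans (*-congˡ y≈0) (zeroʳ x)
    ; *-nonZero  = *-nonZero
    }

  module FP = Polynomials fieldDomain

  coeff≡coeffₗ : ∀ p n → coeff p n ≡ FP.coeffₗ p n
  coeff≡coeffₗ []      n       = refl
  coeff≡coeffₗ (a ∷ p) zero    = refl
  coeff≡coeffₗ (a ∷ p) (suc n) = coeff≡coeffₗ p n

  +ₚ≡+ₗ : ∀ p p' → p +ₚ p' ≡ p FP.+ₗ p'
  +ₚ≡+ₗ []      p'       = refl
  +ₚ≡+ₗ (a ∷ p) []       = refl
  +ₚ≡+ₗ (a ∷ p) (b ∷ p') = cong (_ ∷_) (+ₚ≡+ₗ p p')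

  ·ₚ≡·ₗ : ∀ a p → a ·ₚ p ≡ a FP.·ₗ p
  ·ₚ≡·ₗ a []      = refl
  ·ₚ≡·ₗ a (b ∷ p) = cong (_ ∷_) (·ₚ≡·ₗ a p)

  *ₚ≡*ₗ : ∀ p p' → p *ₚ p' ≡ p FP.*ₗ p'
  *ₚ≡*ₗ []      p' = refl
  *ₚ≡*ₗ (a ∷ p) p' = trans (+ₚ≡+ₗ (a ·ₚ p') _) (cong₂ FP._+ₗ_ (·ₚ≡·ₗ a p') (cong (0# ∷_) (*ₚ≡*ₗ p p')))

  ≈[]⇒isZeroPoly : ∀ p → p ≈ₚ [] → FP.IsZeroPoly p
  ≈[]⇒isZeroPoly p p≈[] n = subst (_≈ 0#) (coeff≡coeffₗ p n) (p≈[] n)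

  isZeroPoly⇒≈[] : ∀ p → FP.IsZeroPoly p → p ≈ₚ []
  isZeroPoly⇒≈[] p h n = subst (_≈ 0#) (sym (coeff≡coeffₗ p n)) (h n)

  +ₚ-zero : ∀ p p' → p ≈ₚ [] → p' ≈ₚ [] → (p +ₚ p') ≈ₚ []
  +ₚ-zero p p' h h' = isZeroPoly⇒≈[] (p +ₚ p') (subst FP.IsZeroPoly (sym (+ₚ≡+ₗ p p'))
    (λ n → FP.+-isZeroCoeff p p' n (≈[]⇒isZeroPoly p h n) (≈[]⇒isZeroPoly p' h' n)))

  *ₚ-zeroˡ : ∀ p p' → p ≈ₚ [] → (p *ₚ p') ≈ₚ []
  *ₚ-zeroˡ p p' h = isZeroPoly⇒≈[] (p *ₚ p') (subst FP.IsZeroPoly (sym (*ₚ≡*ₗ p p'))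
    (FP.*-isZeroPolyˡ p p' (≈[]⇒isZeroPoly p h)))

  *ₚ-zeroʳ : ∀ p p' → p' ≈ₚ [] → (p *ₚ p') ≈ₚ []
  *ₚ-zeroʳ p p' h = isZeroPoly⇒≈[] (p *ₚ p') (subst FP.IsZeroPoly (sym (*ₚ≡*ₗ p p'))
    (FP.*-isZeroPolyʳ p p' (≈[]⇒isZeroPoly p' h)))

  *ₚ-nonZero : ∀ p p' → ¬ p ≈ₚ [] → ¬ p' ≈ₚ [] → ¬ (p *ₚ p') ≈ₚ []
  *ₚ-nonZero p p' np np' h = FP.*-nonZeroPoly ≈0? p p' (λ _ → tt) (λ _ → tt)
    (np ∘ isZeroPoly⇒≈[] p) (np' ∘ isZeroPoly⇒≈[] p')
    (subst FP.IsZeroPoly (*ₚ≡*ₗ p p') (≈[]⇒isZeroPoly (p *ₚ p') h))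

  +ₚ-nonZeroˡ : ∀ p p' → ¬ p ≈ₚ [] → p' ≈ₚ [] → ¬ (p +ₚ p') ≈ₚ []
  +ₚ-nonZeroˡ p p' np h' h = FP.+-nonZeroPolyˡ ≈0? p p'
    (np ∘ isZeroPoly⇒≈[] p) (≈[]⇒isZeroPoly p' h') (λ _ → tt)
    (subst FP.IsZeroPoly (+ₚ≡+ₗ p p') (≈[]⇒isZeroPoly (p +ₚ p') h))

  +ₚ-nonZeroʳ : ∀ p p' → p ≈ₚ [] → ¬ p' ≈ₚ [] → ¬ (p +ₚ p') ≈ₚ []
  +ₚ-nonZeroʳ p p' h np' h'' = FP.+-nonZeroPolyʳ ≈0? p p'
    (≈[]⇒isZeroPoly p h) (λ _ → tt) (np' ∘ isZeroPoly⇒≈[] p')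
    (subst FP.IsZeroPoly (+ₚ≡+ₗ p p') (≈[]⇒isZeroPoly (p +ₚ p') h''))

  1ₚ≉0 : ¬ const 1# ≈ₚ []
  1ₚ≉0 h = one≉zero (h 0)

  fractionDomain : DomainLike c ℓ ℓ
  fractionDomain = record
    { Carrier    = K
    ; 0#         = 0K
    ; 1#         = 1K
    ; _⊕_        = _+K_
    ; _⊛_        = _*K_
    ; IsZero     = λ x → num x ≈ₚ []
    ; Valid      = ValidK
    ; 0-isZero   = λ _ → ≈-refl
    ; 1-nonZero  = 1ₚ≉0
    ; 0-valid    = 1ₚ≉0
    ; 1-valid    = 1ₚ≉0
    ; +-valid    = λ {x} {y} → *ₚ-nonZero (den x) (den y)
    ; *-valid    = λ {x} {y} → *ₚ-nonZero (den x) (den y)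
    ; +-isZero   = λ {x} {y} x≈0 y≈0 →
        +ₚ-zero (num x *ₚ den y) (num y *ₚ den x) (*ₚ-zeroˡ (num x) (den y) x≈0) (*ₚ-zeroˡ (num y) (den x) y≈0)
    ; +-nonZeroˡ = λ {x} {y} x≉0 y≈0 y-valid →
        +ₚ-nonZeroˡ (num x *ₚ den y) (num y *ₚ den x) (*ₚ-nonZero (num x) (den y) x≉0 y-valid) (*ₚ-zeroˡ (num y) (den x) y≈0)
    ; +-nonZeroʳ = λ {x} {y} x≈0 x-valid y≉0 →
        +ₚ-nonZeroʳ (num x *ₚ den y) (num y *ₚ den x) (*ₚ-zeroˡ (num x) (den y) x≈0) (*ₚ-nonZero (num y) (den x) y≉0 x-valid)
    ; *-isZeroˡ  = λ {x} {y} → *ₚ-zeroˡ (num x) (num y)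
    ; *-isZeroʳ  = λ {x} {y} → *ₚ-zeroʳ (num x) (num y)
    ; *-nonZero  = λ {x} {y} → *ₚ-nonZero (num x) (num y)
    }

  open Polynomials fractionDomain

  coeffZ≡coeffₗ : ∀ p n → coeffZ p n ≡ coeffₗ p n
  coeffZ≡coeffₗ []      n       = refl
  coeffZ≡coeffₗ (a ∷ p) zero    = refl
  coeffZ≡coeffₗ (a ∷ p) (suc n) = coeffZ≡coeffₗ p n

  +Z≡+ₗ : ∀ p p' → p +Z p' ≡ p +ₗ p'
  +Z≡+ₗ []      p'       = refl
  +Z≡+ₗ (a ∷ p) []       = refl
  +Z≡+ₗ (a ∷ p) (b ∷ p') = cong (_ ∷_) (+Z≡+ₗ p p')

  ·Z≡·ₗ : ∀ a p → a ·Z p ≡ a ·ₗ p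
  ·Z≡·ₗ a []      = refl
  ·Z≡·ₗ a (b ∷ p) = cong (_ ∷_) (·Z≡·ₗ a p)

  *Z≡*ₗ : ∀ p p' → p *Z p' ≡ p *ₗ p'
  *Z≡*ₗ []      p' = refl
  *Z≡*ₗ (a ∷ p) p' = trans (+Z≡+ₗ (a ·Z p') _) (cong₂ _+ₗ_ (·Z≡·ₗ a p') (cong (0K ∷_) (*Z≡*ₗ p p')))

  ^Z≡^ₗ : ∀ p n → p ^Z n ≡ p ^ₗ n
  ^Z≡^ₗ p zero    = refl
  ^Z≡^ₗ p (suc n) = trans (*Z≡*ₗ p (p ^Z n)) (cong (p *ₗ_) (^Z≡^ₗ p n))

  *ₚ-identityʳ-coeff : ∀ p n → coeff (p *ₚ const 1#) n ≈ coeff p n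
  *ₚ-identityʳ-coeff []      n       = ≈-refl
  *ₚ-identityʳ-coeff (a ∷ p) zero    = ≈-trans (+ᶠ-identityʳ _) (*ᶠ-identityʳ a)
  *ₚ-identityʳ-coeff (a ∷ p) (suc n) = *ₚ-identityʳ-coeff p n

  ≈K0⇒num≈[] : ∀ x → x ≈K 0K → num x ≈ₚ []
  ≈K0⇒num≈[] x h n = ≈-trans (≈-sym (*ₚ-identityʳ-coeff (num x) n)) (h n)

  num≈[]⇒≈K0 : ∀ x → num x ≈ₚ [] → x ≈K 0K
  num≈[]⇒≈K0 x h n = ≈-trans (*ₚ-identityʳ-coeff (num x) n) (h n)

  exactDegree⇒HasDegreeZ : ∀ p {d} → ExactDegree p d → HasDegreeZ p d
  exactDegree⇒HasDegreeZ p {d} (nz , below) =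
    (λ h → nz (subst (λ x → num x ≈ₚ []) (coeffZ≡coeffₗ p d) (≈K0⇒num≈[] (coeffZ p d) h))) ,
    (λ m d<m → num≈[]⇒≈K0 (coeffZ p m) (subst (λ x → num x ≈ₚ []) (sym (coeffZ≡coeffₗ p m)) (below m d<m)))

  constant-exactDegree : ∀ a → ¬ a ≈K 0K → ExactDegree (a ∷ []) 0
  constant-exactDegree a a≉0 = (λ h → a≉0 (num≈[]⇒≈K0 a h)) , λ { (suc m) _ _ → ≈-refl }

  constant-allValid : ∀ a → ValidK a → AllValid (a ∷ [])
  constant-allValid a a-valid = ∷-allValid a-valid (λ _ → 1ₚ≉0)

  module _ (r : ℕ) where
    open Drinfeld q r

    z-exactDegree : ExactDegree z 1
    z-exactDegree = 1ₚ≉0 , λ { zero () ; (suc zero) (s≤s ()) ; (suc (suc m)) _ _ → ≈-refl }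

    z-allValid : AllValid z
    z-allValid zero          = 1ₚ≉0
    z-allValid (suc zero)    = 1ₚ≉0
    z-allValid (suc (suc _)) = 1ₚ≉0

    ΦT≡ : ∀ x → ΦT x ≡ tK ·ₗ x +ₗ (z *ₗ x ^ₗ q +ₗ x ^ₗ (q ^ r))
    ΦT≡ x = trans (+Z≡+ₗ (tK ·Z x) _) (cong₂ _+ₗ_ (·Z≡·ₗ tK x) (trans (+Z≡+ₗ (z *Z (x ^Z q)) _)
      (cong₂ _+ₗ_ (trans (*Z≡*ₗ z (x ^Z q)) (cong (z *ₗ_) (^Z≡^ₗ x q))) (^Z≡^ₗ x (q ^ r)))))

    ΦT-allValid : ∀ x → AllValid x → AllValid (ΦT x)
    ΦT-allValid x v = subst AllValid (sym (ΦT≡ x))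
      (+-allValid (tK ·ₗ x) (z *ₗ x ^ₗ q +ₗ x ^ₗ (q ^ r)) (·-allValid tK x 1ₚ≉0 v)
        (+-allValid (z *ₗ x ^ₗ q) (x ^ₗ (q ^ r)) (*-allValid z (x ^ₗ q) z-allValid (^-allValid x q v)) (^-allValid x (q ^ r) v)))

    ΦT-exactDegree-constant : ∀ x → AllValid x → ExactDegree x 0 → ExactDegree (ΦT x) 1
    ΦT-exactDegree-constant x v ed = subst (λ w → ExactDegree w 1) (sym (ΦT≡ x))
      (+-exactDegreeʳ (tK ·ₗ x) (z *ₗ x ^ₗ q +ₗ x ^ₗ (q ^ r)) (·-degreeBelow tK x (proj₂ ed)) (·-allValid tK x 1ₚ≉0 v)
        (+-exactDegreeˡ (z *ₗ x ^ₗ q) (x ^ₗ (q ^ r))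
          (*-exactDegree z (x ^ₗ q) z-exactDegree z-allValid (constant-power q) (^-allValid x q v))
          (exactDegree⇒degreeBelow (x ^ₗ (q ^ r)) (constant-power (q ^ r)) ≤-refl)
          (^-allValid x (q ^ r) v)))
      where
      constant-power : ∀ n → ExactDegree (x ^ₗ n) 0
      constant-power n = subst (ExactDegree (x ^ₗ n)) (*-zeroʳ n) (^-exactDegree x ed v n)

    ΦT-exactDegree : 2 ≤ q → 2 ≤ r → ∀ x {D} → AllValid x → ExactDegree x D → 1 ≤ D → ExactDegree (ΦT x) (q ^ r * D)
    ΦT-exactDegree q≥2 r≥2 x {D} v ed D≥1 = subst (λ w → ExactDegree w (q ^ r * D)) (sym (ΦT≡ x))
      (+-exactDegreeʳ (tK ·ₗ x) (z *ₗ x ^ₗ q +ₗ x ^ₗ (q ^ r))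
        (·-degreeBelow tK x (degreeBelow-mono x (proj₂ ed) (1+D≤q^r*D q≥2 r≥2 D≥1)))
        (·-allValid tK x 1ₚ≉0 v)
        (+-exactDegreeʳ (z *ₗ x ^ₗ q) (x ^ₗ (q ^ r))
          (exactDegree⇒degreeBelow (z *ₗ x ^ₗ q)
            (*-exactDegree z (x ^ₗ q) z-exactDegree z-allValid (^-exactDegree x ed v q) (^-allValid x q v))
            (2+q*D≤q^r*D q≥2 r≥2 D≥1))
          (*-allValid z (x ^ₗ q) z-allValid (^-allValid x q v))
          (^-exactDegree x ed v (q ^ r))))

    ΦT^-allValid : ∀ x → AllValid x → ∀ i → AllValid (ΦT^ i x)
    ΦT^-allValid x v zero    = v
    ΦT^-allValid x v (suc i) = ΦT-allValid (ΦT^ i x) (ΦT^-allValid x v i)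

    ΦT^-exactDegree : 2 ≤ q → 2 ≤ r → ∀ x → AllValid x → ExactDegree x 0 →
      ∀ i → ExactDegree (ΦT^ i x) (iterateDegree q r i)
    ΦT^-exactDegree q≥2 r≥2 x v ed zero = ed
    ΦT^-exactDegree q≥2 r≥2 x v ed (suc zero) =
      subst (ExactDegree (ΦT x)) (cong (q ^_) (sym (*-zeroʳ r))) (ΦT-exactDegree-constant x v ed)
    ΦT^-exactDegree q≥2 r≥2 x v ed (suc (suc i)) = subst (ExactDegree (ΦT^ (suc (suc i)) x)) (iterateDegree-step q r i)
      (ΦT-exactDegree q≥2 r≥2 (ΦT^ (suc i) x) (ΦT^-allValid x v (suc i)) (ΦT^-exactDegree q≥2 r≥2 x v ed (suc i))
        (m^n>0 q (r * i)))
      where instance _ = >-nonZero (≤-trans (n≤1+n 1) q≥2)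

    ΦP-from-∷ : ∀ i c P x → ΦP-from i (c ∷ P) x ≡ ιK c ·ₗ ΦT^ i x +ₗ ΦP-from (suc i) P x
    ΦP-from-∷ i c P x = trans (+Z≡+ₗ (ιK c ·Z ΦT^ i x) _) (cong (_+ₗ ΦP-from (suc i) P x) (·Z≡·ₗ (ιK c) (ΦT^ i x)))

    ΦP-from-allValid : ∀ x → (∀ j → AllValid (ΦT^ j x)) → ∀ i P → AllValid (ΦP-from i P x)
    ΦP-from-allValid x v i []      _ = 1ₚ≉0
    ΦP-from-allValid x v i (c ∷ P)   = subst AllValid (sym (ΦP-from-∷ i c P x))
      (+-allValid (ιK c ·ₗ ΦT^ i x) (ΦP-from (suc i) P x)
        (·-allValid (ιK c) (ΦT^ i x) 1ₚ≉0 (v i)) (ΦP-from-allValid x v (suc i) P))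

    ΦP-from-isZeroPoly : ∀ x i P → (∀ k → coeff P k ≈ 0#) → IsZeroPoly (ΦP-from i P x)
    ΦP-from-isZeroPoly x i []      _ _ _ = ≈-refl
    ΦP-from-isZeroPoly x i (c ∷ P) h   = subst IsZeroPoly (sym (ΦP-from-∷ i c P x)) λ n →
      +-isZeroCoeff (ιK c ·ₗ ΦT^ i x) (ΦP-from (suc i) P x) n
        (·-isZeroCoeffˡ (ιK c) (ΦT^ i x) n λ { zero → h 0 ; (suc _) → ≈-refl })
        (ΦP-from-isZeroPoly x (suc i) P (h ∘ suc) n)

    ΦP-from-exactDegree : ∀ x (e : ℕ → ℕ) → (∀ j → e j < e (suc j)) →
      (∀ j → AllValid (ΦT^ j x)) → (∀ j → ExactDegree (ΦT^ j x) (e j)) →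
      ∀ i P d → HasDegree P d → ExactDegree (ΦP-from i P x) (e (d + i))
    ΦP-from-exactDegree x e inc v deg i [] d (nz , _) = ⊥-elim (nz ≈-refl)
    ΦP-from-exactDegree x e inc v deg i (c ∷ P) zero (c≉0 , above) =
      subst (λ w → ExactDegree w (e i)) (sym (ΦP-from-∷ i c P x))
        (+-exactDegreeˡ (ιK c ·ₗ ΦT^ i x) (ΦP-from (suc i) P x)
          (·-exactDegree (ιK c) (ΦT^ i x) (λ h → c≉0 (h 0)) (deg i))
          (λ m _ → ΦP-from-isZeroPoly x (suc i) P (λ k → above (suc k) (s≤s z≤n)) m)
          (ΦP-from-allValid x v (suc i) P))
    ΦP-from-exactDegree x e inc v deg i (c ∷ P) (suc d) (nz , above) =
      subst (λ w → ExactDegree w (e (suc d + i))) (sym (ΦP-from-∷ i c P x))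
        (+-exactDegreeʳ (ιK c ·ₗ ΦT^ i x) (ΦP-from (suc i) P x)
          (degreeBelow-mono (ιK c ·ₗ ΦT^ i x) (·-degreeBelow (ιK c) (ΦT^ i x) (proj₂ (deg i)))
            (increasing⇒< e inc d i))
          (·-allValid (ιK c) (ΦT^ i x) 1ₚ≉0 (v i))
          (subst (ExactDegree (ΦP-from (suc i) P x)) (cong e (+-suc d i))
            (ΦP-from-exactDegree x e inc v deg (suc i) P d (nz , λ m d<m → above (suc m) (s≤s d<m)))))

lemma2p4 : {c ℓ : Level} (q r : ℕ) (F : CommutativeRing c ℓ) →
    IsPrimePower q → IsFiniteFieldOfSize F q → 2 ≤ r →
    let open Poly F in
    let open RatFun F in
    let open Drinfeld q r in
    (a : K) → ValidK a → ¬ (a ≈K 0K) →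
    (P : Pol) (d : ℕ) → HasDegree P d → 1 ≤ d →
    HasDegreeZ (Φ P (a ∷ [])) (q ^ (r * (d ∸ 1)))
lemma2p4 q r F q-prime-power F-field r≥2 a a-valid a≉0 P (suc d) P-degree _ =
  exactDegree⇒HasDegreeZ F F-field (Φ P x)
    (subst (ExactDegree (Φ P x)) (cong (λ k → q ^ (r * k)) (+-identityʳ d))
      (ΦP-from-exactDegree F F-field r x (iterateDegree q r)
        (iterateDegree-increasing q≥2 (≤-trans (n≤1+n 1) r≥2)) x-iterates-valid x-iterates-degree 0 P (suc d) P-degree))
  where
  open RatFun F using (K; module Drinfeld)
  open Drinfeld q r
  open Polynomials (fractionDomain F F-field)

  q≥2 : 2 ≤ q
  q≥2 = isPrimePower⇒2≤ q-prime-power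

  x : List K
  x = a ∷ []

  x-iterates-valid : ∀ i → AllValid (ΦT^ i x)
  x-iterates-valid = ΦT^-allValid F F-field r x (constant-allValid F F-field a a-valid)

  x-iterates-degree : ∀ i → ExactDegree (ΦT^ i x) (iterateDegree q r i)
  x-iterates-degree = ΦT^-exactDegree F F-field r q≥2 r≥2 x (constant-allValid F F-field a a-valid)
    (constant-exactDegree F F-field a a≉0)
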